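{- Let $M$ be a matroid and let $m,n$ be positive integers. Let $A$ be an $m\times n$ matrix whose entries are elements of $M$, and suppose that for each row of $A$, the set of entries of that row is an independent set of size $n$ in $M$ (in particular the entries within a row are distinct). If $m\ge 2n-1$, then $A$ has an independent transversal, i.e., there exist $n$ entries of $A$, lying in $n$ distinct rows and in $n$ distinct columns (so one in each column), which are distinct elements of $M$ and which together form an independent set in $M$. -}

module Defs where

open import Level using (Level; suc; _⊔_)
open import Data.Nat using (ℕ; _<_)
open import Data.Fin using (Fin)
open import Data.Fin.Subset using (Subset; _⊆_; ⊥; ∣_∣; _∈_; _∉_; _∪_; ⁅_⁆; ⋃)
open import Data.Product using (∃; _×_)
open import Data.List using (List)
open import Data.Vec.Functional using (toList)
open import Function.Definitions using (Injective)
open import Relation.Binary.PropositionalEquality using (_≡_)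

record Matroid (N : ℕ) : Set₁ where
  field
    Independent : Subset N → Set
    empty-indep : Independent ⊥
    hereditary  : ∀ {I J} → J ⊆ I → Independent I → Independent J
    exchange    : ∀ {I J} → Independent I → Independent J → ∣ I ∣ < ∣ J ∣ →
                  ∃ λ x → x ∈ J × x ∉ I × Independent (I ∪ ⁅ x ⁆)

setOf : ∀ {N k} → (Fin k → Fin N) → Subset N
setOf f = ⋃ (toList (λ i → ⁅ f i ⁆))

IndepFamily : ∀ {N k} → Matroid N → (Fin k → Fin N) → Set
IndepFamily M f = Injective _≡_ _≡_ f × Matroid.Independent M (setOf f)

IndependentTransversal : ∀ {N m n} → Matroid N → (Fin m → Fin n → Fin N) → Set
IndependentTransversal {n = n} M A =
  ∃ λ (ρ : Fin n → Fin _) → Injective _≡_ _≡_ ρ × IndepFamily M (λ j → A (ρ j) j)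

-- Induction on the number of columns. An independent transversal of all columns but the first is a
-- partial transversal with a hole in column 0. A move puts an unused row r into the hole and opens a
-- hole in another column c, keeping the chosen entries distinct and independent; if the new entry can
-- simply be added, we are done. Suppose we are never done. For a set P of forbidden rows, let W contain
-- the holes of everything reachable by moves with rows outside P. Then every entry in a column of W of
-- a reachable partial transversal is spanned by the entries of the start in W. Forbidding a further row
-- r₀ unused at the start, the holes stay among the columns w with A r₀ w spanned by those |W| − 1
-- entries, and as row r₀ is independent there are fewer than |W| such columns. Since m ≥ 2n − 1 there
-- are enough fresh rows to shrink W from n columns to one, yet a move with one more fresh row always
-- reaches a second hole. Independence in an arbitrary matroid is not decidable constructively, so the
-- argument runs in a decidable submatroid: the sets below the closure of the rows under exchange.

module Submission where

open import Defs
open import Data.Bool using (Bool; true; false; T; _∧_; _∨_; if_then_else_)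
open import Data.Bool.Properties using (T?; T-∨)
import Data.Bool.Properties as Bool
open import Data.Empty using (⊥-elim)
open import Data.Fin using (Fin; zero; suc; _≟_; fromℕ<)
import Data.Fin.Properties as Fin
open import Data.Fin.Subset
open import Data.Fin.Subset.Properties
open import Data.Maybe using (Maybe; just; nothing)
open import Data.Nat
  using (ℕ; zero; suc; _≤_; _<_; z≤n; s≤s; _+_; _*_; _∸_; _^_; _≤?_; _<?_; NonZero)
open import Data.Nat.Properties
  using ( ≤-refl; ≤-trans; ≤-reflexive; ≤-antisym; ≤-pred; <-≤-trans; ≤-<-trans; ≰⇒>; n≮n; suc-injective
        ; +-suc; +-identityʳ; +-mono-≤; +-monoʳ-≤; m≤m+n; m≤n+m; n≤1+n; m∸n+n≡m; ∸-monoˡ-≤; *-monoʳ-≤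
        ; module ≤-Reasoning)
open import Data.Product using (∃; _×_; _,_; proj₁; proj₂; map₂)
open import Data.Sum using (_⊎_; inj₁; inj₂; fromInj₁)
import Data.Sum.Effectful.Left as Sumₗ
open import Data.Unit using (tt)
open import Data.Vec using ([]; _∷_; here; there)
import Data.Vec.Functional as Vector
open import Data.Vec.Functional using (updateAt)
open import Data.Vec.Functional.Properties using (updateAt-updates; updateAt-minimal)
import Data.Vec.Properties as Vec
open import Effect.Monad using (RawMonad)
open import Function using (_∘_; id; const; Equivalence)
open import Function.Definitions using (Injective)
open import Level using (Level; 0ℓ)
open import Relation.Nullary using (¬_; Dec; yes; no; does; ¬?)
open import Relation.Nullary.Decidable using (⌊_⌋; _×-dec_; toWitness; fromWitness; decidable-stable)
open import Relation.Unary using (Pred; Decidable)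
open import Relation.Binary.PropositionalEquality using (_≡_; _≢_; refl; sym; trans; cong; subst)

private
  variable
    ℓ : Level
    k N : ℕ

x∉p⇒∣p∪⁅x⁆∣≡1+∣p∣ : ∀ {p : Subset k} {x} → x ∉ p → ∣ p ∪ ⁅ x ⁆ ∣ ≡ suc ∣ p ∣
x∉p⇒∣p∪⁅x⁆∣≡1+∣p∣ {p = outside ∷ p} {zero}  _   = cong (suc ∘ ∣_∣) (∪-identityʳ p)
x∉p⇒∣p∪⁅x⁆∣≡1+∣p∣ {p = inside ∷ p}  {zero}  x∉p = ⊥-elim (x∉p here)
x∉p⇒∣p∪⁅x⁆∣≡1+∣p∣ {p = outside ∷ p} {suc x} x∉p = x∉p⇒∣p∪⁅x⁆∣≡1+∣p∣ (x∉p ∘ there)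
x∉p⇒∣p∪⁅x⁆∣≡1+∣p∣ {p = inside ∷ p}  {suc x} x∉p = cong suc (x∉p⇒∣p∪⁅x⁆∣≡1+∣p∣ (x∉p ∘ there))

x∈p⇒1+∣p-x∣≡∣p∣ : ∀ {p : Subset k} {x} → x ∈ p → suc ∣ p - x ∣ ≡ ∣ p ∣
x∈p⇒1+∣p-x∣≡∣p∣ {p = inside ∷ p}  {zero}  here      = cong (suc ∘ ∣_∣) (p─⊥≡p p)
x∈p⇒1+∣p-x∣≡∣p∣ {p = outside ∷ p} {suc x} (there h) = x∈p⇒1+∣p-x∣≡∣p∣ h
x∈p⇒1+∣p-x∣≡∣p∣ {p = inside ∷ p}  {suc x} (there h) = cong suc (x∈p⇒1+∣p-x∣≡∣p∣ h)

x∉p-x : ∀ (p : Subset k) x → x ∉ p - x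
x∉p-x (_ ∷ p) (suc x) (there h) = x∉p-x p x h

x∈p-y⇒x∈p : ∀ (p : Subset k) {x y} → x ∈ p - y → x ∈ p
x∈p-y⇒x∈p p {y = y} = p─q⊆p p ⁅ y ⁆

x∈p-y⇒x≢y : ∀ (p : Subset k) {x y} → x ∈ p - y → x ≢ y
x∈p-y⇒x≢y p h refl = x∉p-x p _ h

y∈p∪⁅y⁆ : ∀ (p : Subset k) y → y ∈ p ∪ ⁅ y ⁆
y∈p∪⁅y⁆ p y = q⊆p∪q p ⁅ y ⁆ (x∈⁅x⁆ y)

x∈p∪⁅y⁆⁻ : ∀ (p : Subset k) y {x} → x ∈ p ∪ ⁅ y ⁆ → x ∈ p ⊎ x ≡ y
x∈p∪⁅y⁆⁻ p y h with x∈p∪q⁻ p ⁅ y ⁆ h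
... | inj₁ x∈p  = inj₁ x∈p
... | inj₂ x∈⁅y⁆ = inj₂ (x∈⁅y⁆⇒x≡y y x∈⁅y⁆)

p⊆q⇒∣q∣≤∣p∣⇒q⊆p : ∀ {p q : Subset k} → p ⊆ q → ∣ q ∣ ≤ ∣ p ∣ → q ⊆ p
p⊆q⇒∣q∣≤∣p∣⇒q⊆p {p = p} {q} p⊆q ∣q∣≤∣p∣ {x} x∈q with x ∈? p
... | yes x∈p = x∈p
... | no  x∉p = ⊥-elim (n≮n _ (<-≤-trans ∣p∣<∣q∣ ∣q∣≤∣p∣))
  where
  p⊆q-x : p ⊆ q - x
  p⊆q-x y∈p = x∈p∧x≢y⇒x∈p-y (p⊆q y∈p) λ { refl → x∉p y∈p }
  ∣p∣<∣q∣ : ∣ p ∣ < ∣ q ∣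
  ∣p∣<∣q∣ = ≤-<-trans (p⊆q⇒∣p∣≤∣q∣ p⊆q-x) (x∈p⇒∣p-x∣<∣p∣ x∈q)

∣p∣<∣q∣⇒∃x∈q∖p : ∀ {p q : Subset k} → ∣ p ∣ < ∣ q ∣ → ∃ λ x → x ∈ q × x ∉ p
∣p∣<∣q∣⇒∃x∈q∖p {p = p} {q} ∣p∣<∣q∣ with nonempty? (q ─ p)
... | yes (x , x∈q─p) = x , p─q⊆p q p x∈q─p , x∈q─p⇒x∉p q p x∈q─p
  where
  x∈q─p⇒x∉p : ∀ {k} (q p : Subset k) {x} → x ∈ q ─ p → x ∉ p
  x∈q─p⇒x∉p (_ ∷ q) (_ ∷ p) (there h) (there h′) = x∈q─p⇒x∉p q p h h′
... | no  q─p-empty = ⊥-elim (n≮n _ (<-≤-trans ∣p∣<∣q∣ (p⊆q⇒∣p∣≤∣q∣ q⊆p)))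
  where
  q⊆p : q ⊆ p
  q⊆p {x} x∈q with x ∈? p
  ... | yes x∈p = x∈p
  ... | no  x∉p = ⊥-elim (q─p-empty (x , x∈p∧x∉q⇒x∈p─q x∈q x∉p))

x≢y⇒2≤∣p∣ : ∀ {p : Subset k} {x y} → x ∈ p → y ∈ p → x ≢ y → 2 ≤ ∣ p ∣
x≢y⇒2≤∣p∣ {p = p} {x} {y} x∈p y∈p x≢y =
  ≤-trans (≤-reflexive (sym ∣⁅x⁆∪⁅y⁆∣≡2)) (p⊆q⇒∣p∣≤∣q∣ ⁅x⁆∪⁅y⁆⊆p)
  where
  ∣⁅x⁆∪⁅y⁆∣≡2 : ∣ ⁅ x ⁆ ∪ ⁅ y ⁆ ∣ ≡ 2
  ∣⁅x⁆∪⁅y⁆∣≡2 = trans (x∉p⇒∣p∪⁅x⁆∣≡1+∣p∣ (x≢y ∘ sym ∘ x∈⁅y⁆⇒x≡y x)) (cong suc (∣⁅x⁆∣≡1 x))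
  ⁅x⁆∪⁅y⁆⊆p : ⁅ x ⁆ ∪ ⁅ y ⁆ ⊆ p
  ⁅x⁆∪⁅y⁆⊆p h with x∈p∪⁅y⁆⁻ ⁅ x ⁆ y h
  ... | inj₁ z∈⁅x⁆ = subst (_∈ p) (sym (x∈⁅y⁆⇒x≡y x z∈⁅x⁆)) x∈p
  ... | inj₂ refl  = y∈p

∣p∪q∣≤∣p∣+∣q∣ : ∀ (p q : Subset k) → ∣ p ∪ q ∣ ≤ ∣ p ∣ + ∣ q ∣
∣p∪q∣≤∣p∣+∣q∣ []            []            = z≤n
∣p∪q∣≤∣p∣+∣q∣ (outside ∷ p) (outside ∷ q) = ∣p∪q∣≤∣p∣+∣q∣ p q
∣p∪q∣≤∣p∣+∣q∣ (outside ∷ p) (inside ∷ q)  = ≤-trans (s≤s (∣p∪q∣≤∣p∣+∣q∣ p q)) (≤-reflexive (sym (+-suc _ _)))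
∣p∪q∣≤∣p∣+∣q∣ (inside ∷ p)  (outside ∷ q) = s≤s (∣p∪q∣≤∣p∣+∣q∣ p q)
∣p∪q∣≤∣p∣+∣q∣ (inside ∷ p)  (inside ∷ q)  = s≤s (≤-trans (∣p∪q∣≤∣p∣+∣q∣ p q) (+-monoʳ-≤ ∣ p ∣ (n≤1+n ∣ q ∣)))

filter : {P : Pred (Fin k) ℓ} → Decidable P → Subset k → Subset k
filter P? []      = []
filter P? (s ∷ p) = (s ∧ does (P? zero)) ∷ filter (P? ∘ suc) p

∈-filter⁺ : {P : Pred (Fin k) ℓ} (P? : Decidable P) {p : Subset k} {x : Fin k} → x ∈ p → P x → x ∈ filter P? p
∈-filter⁺ P? {x = zero} here Px with P? zero
... | yes _   = here
... | no  ¬Px = ⊥-elim (¬Px Px)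
∈-filter⁺ P? {x = suc x} (there h) Px = there (∈-filter⁺ (P? ∘ suc) h Px)

∈-filter⁻ : {P : Pred (Fin k) ℓ} (P? : Decidable P) {p : Subset k} {x : Fin k} → x ∈ filter P? p → x ∈ p × P x
∈-filter⁻ P? {p = inside ∷ p} {zero} h with P? zero
∈-filter⁻ P? {p = inside ∷ p} {zero} here | yes Px = here , Px
∈-filter⁻ P? {p = _ ∷ p} {suc x} (there h) with ∈-filter⁻ (P? ∘ suc) h
... | x∈p , Px = there x∈p , Px

image : (Fin k → Fin N) → Subset k → Subset N
image f []            = ⊥
image f (inside ∷ p)  = ⁅ f zero ⁆ ∪ image (f ∘ suc) p
image f (outside ∷ p) = image (f ∘ suc) p

∈-image⁺ : ∀ (f : Fin k → Fin N) {p x} → x ∈ p → f x ∈ image f p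
∈-image⁺ f {inside ∷ p}  here      = p⊆p∪q _ (x∈⁅x⁆ (f zero))
∈-image⁺ f {inside ∷ p}  (there h) = q⊆p∪q ⁅ f zero ⁆ _ (∈-image⁺ (f ∘ suc) h)
∈-image⁺ f {outside ∷ p} (there h) = ∈-image⁺ (f ∘ suc) h

∈-image⁻ : ∀ (f : Fin k → Fin N) p {y} → y ∈ image f p → ∃ λ x → x ∈ p × f x ≡ y
∈-image⁻ f []           h = ⊥-elim (∉⊥ h)
∈-image⁻ f (inside ∷ p) h with x∈p∪q⁻ ⁅ f zero ⁆ (image (f ∘ suc) p) h
... | inj₁ h₁ = zero , here , sym (x∈⁅y⁆⇒x≡y (f zero) h₁)
... | inj₂ h₂ with ∈-image⁻ (f ∘ suc) p h₂
...   | x , x∈p , fx≡y = suc x , there x∈p , fx≡y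
∈-image⁻ f (outside ∷ p) h with ∈-image⁻ (f ∘ suc) p h
... | x , x∈p , fx≡y = suc x , there x∈p , fx≡y

y∉image⊥ : ∀ (f : Fin k → Fin N) {y} → y ∉ image f ⊥
y∉image⊥ f h = ∉⊥ (proj₁ (proj₂ (∈-image⁻ f ⊥ h)))

InjectiveOn : (Fin k → Fin N) → Subset k → Set
InjectiveOn f p = ∀ {x y} → x ∈ p → y ∈ p → f x ≡ f y → x ≡ y

injectiveOn-tail : ∀ {f : Fin (suc k) → Fin N} {s p} → InjectiveOn f (s ∷ p) → InjectiveOn (f ∘ suc) p
injectiveOn-tail inj x∈p y∈p = Fin.suc-injective ∘ inj (there x∈p) (there y∈p)

∣⊤-x∣≡n : ∀ {n} (x : Fin (suc n)) → ∣ ⊤ - x ∣ ≡ n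
∣⊤-x∣≡n {n} x = suc-injective (trans (x∈p⇒1+∣p-x∣≡∣p∣ (∈⊤ {x = x})) (∣⊤∣≡n (suc n)))

∣image∣≡∣p∣ : ∀ (f : Fin k → Fin N) p → InjectiveOn f p → ∣ image f p ∣ ≡ ∣ p ∣
∣image∣≡∣p∣ {N = N} f [] _ = ∣⊥∣≡0 N
∣image∣≡∣p∣ f (inside ∷ p) inj =
  trans (cong ∣_∣ (∪-comm ⁅ f zero ⁆ (image (f ∘ suc) p)))
        (trans (x∉p⇒∣p∪⁅x⁆∣≡1+∣p∣ f0∉) (cong suc (∣image∣≡∣p∣ (f ∘ suc) p (injectiveOn-tail inj))))
  where
  f0∉ : f zero ∉ image (f ∘ suc) p
  f0∉ h with ∈-image⁻ (f ∘ suc) p h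
  ... | x , x∈p , eq with inj here (there x∈p) (sym eq)
  ...   | ()
∣image∣≡∣p∣ f (outside ∷ p) inj = ∣image∣≡∣p∣ (f ∘ suc) p (injectiveOn-tail inj)

∈-setOf⁺ : ∀ (f : Fin k → Fin N) x → f x ∈ setOf f
∈-setOf⁺ f zero    = p⊆p∪q _ (x∈⁅x⁆ (f zero))
∈-setOf⁺ f (suc x) = q⊆p∪q ⁅ f zero ⁆ _ (∈-setOf⁺ (f ∘ suc) x)

∈-setOf⁻ : ∀ (f : Fin k → Fin N) {y} → y ∈ setOf f → ∃ λ x → f x ≡ y
∈-setOf⁻ {k = zero}  f h = ⊥-elim (∉⊥ h)
∈-setOf⁻ {k = suc k} f h with x∈p∪q⁻ ⁅ f zero ⁆ (setOf (f ∘ suc)) h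
... | inj₁ h₁ = zero , sym (x∈⁅y⁆⇒x≡y (f zero) h₁)
... | inj₂ h₂ with ∈-setOf⁻ (f ∘ suc) h₂
...   | x , fx≡y = suc x , fx≡y

injective-off-zero : ∀ {a} {B : Set a} {f : Fin (suc k) → B} → Injective _≡_ _≡_ (f ∘ suc) →
                     ∀ {x y} → x ≢ zero → y ≢ zero → f x ≡ f y → x ≡ y
injective-off-zero _   {zero}          x≢0 _   _  = ⊥-elim (x≢0 refl)
injective-off-zero _   {suc _} {zero}  _   y≢0 _  = ⊥-elim (y≢0 refl)
injective-off-zero inj {suc _} {suc _} _   _   eq = cong suc (inj eq)

_⊆ᵇ_ : (f g : Subset k → Bool) → Set
f ⊆ᵇ g = ∀ {X} → T (f X) → T (g X)

count : (Subset k → Bool) → ℕ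
count {zero}  f = if f [] then 1 else 0
count {suc k} f = count (f ∘ (outside ∷_)) + count (f ∘ (inside ∷_))

count≤2^k : ∀ (f : Subset k → Bool) → count f ≤ 2 ^ k
count≤2^k {zero} f with f []
... | true  = ≤-refl
... | false = z≤n
count≤2^k {suc k} f = ≤-trans (+-mono-≤ (count≤2^k (f ∘ (outside ∷_))) (count≤2^k (f ∘ (inside ∷_))))
                             (≤-reflexive (cong (2 ^ k +_) (sym (+-identityʳ (2 ^ k)))))

count-mono : ∀ {f g : Subset k → Bool} → f ⊆ᵇ g → count f ≤ count g
count-mono {zero} {f} {g} f⊆g with f [] | g [] | f⊆g {[]}
... | false | _     | _    = z≤n
... | true  | true  | _    = ≤-refl
... | true  | false | f⇒g = ⊥-elim (f⇒g tt)
count-mono {suc k} {f} f⊆g = +-mono-≤ (count-mono {f = f ∘ (outside ∷_)} f⊆g) (count-mono {f = f ∘ (inside ∷_)} f⊆g)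

count-< : ∀ {f g : Subset k → Bool} → f ⊆ᵇ g → ∀ X → T (g X) → ¬ T (f X) → count f < count g
count-< {zero} {f} {g} f⊆g [] gX ¬fX with f [] | g []
... | false | true = ≤-refl
... | true  | _    = ⊥-elim (¬fX tt)
count-< {suc k} {f} f⊆g (outside ∷ X) gX ¬fX =
  +-mono-≤ (count-< {f = f ∘ (outside ∷_)} f⊆g X gX ¬fX) (count-mono {f = f ∘ (inside ∷_)} f⊆g)
count-< {suc k} {f} f⊆g (inside ∷ X) gX ¬fX =
  ≤-trans (≤-reflexive (sym (+-suc _ _)))
          (+-mono-≤ (count-mono {f = f ∘ (outside ∷_)} f⊆g) (count-< {f = f ∘ (inside ∷_)} f⊆g X gX ¬fX))


module MatroidProperties {N : ℕ} (M : Matroid N) where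
  open Matroid M

  -- For independent B this says that x lies in the closure of B.
  _Spans_ : Subset N → Fin N → Set
  B Spans x = Independent (B ∪ ⁅ x ⁆) → x ∈ B

  augment : ∀ {X Y} → Independent X → Independent Y → ∣ X ∣ ≤ ∣ Y ∣ →
            ∃ λ Z → X ⊆ Z × Z ⊆ X ∪ Y × ∣ Z ∣ ≡ ∣ Y ∣ × Independent Z
  augment {X} {Y} iX iY ∣X∣≤∣Y∣ = grow (∣ Y ∣ ∸ ∣ X ∣) id (p⊆p∪q Y) iX (m∸n+n≡m ∣X∣≤∣Y∣)
    where
    grow : ∀ d {Z} → X ⊆ Z → Z ⊆ X ∪ Y → Independent Z → d + ∣ Z ∣ ≡ ∣ Y ∣ →
           ∃ λ Z′ → X ⊆ Z′ × Z′ ⊆ X ∪ Y × ∣ Z′ ∣ ≡ ∣ Y ∣ × Independent Z′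
    grow zero    {Z} X⊆Z Z⊆X∪Y iZ d+∣Z∣≡∣Y∣ = Z , X⊆Z , Z⊆X∪Y , d+∣Z∣≡∣Y∣ , iZ
    grow (suc d) {Z} X⊆Z Z⊆X∪Y iZ d+∣Z∣≡∣Y∣
      with exchange iZ iY (≤-trans (s≤s (m≤n+m ∣ Z ∣ d)) (≤-reflexive d+∣Z∣≡∣Y∣))
    ... | x , x∈Y , x∉Z , iZ∪x = grow d (p⊆p∪q ⁅ x ⁆ ∘ X⊆Z) Z∪x⊆X∪Y iZ∪x
            (trans (cong (d +_) (x∉p⇒∣p∪⁅x⁆∣≡1+∣p∣ x∉Z)) (trans (+-suc d ∣ Z ∣) d+∣Z∣≡∣Y∣))
      where
      Z∪x⊆X∪Y : Z ∪ ⁅ x ⁆ ⊆ X ∪ Y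
      Z∪x⊆X∪Y h with x∈p∪⁅y⁆⁻ Z x h
      ... | inj₁ z∈Z = Z⊆X∪Y z∈Z
      ... | inj₂ refl = q⊆p∪q X Y x∈Y

  spanned⇒∣X∣≤∣B∣ : ∀ {X B} → Independent X → Independent B → (∀ {x} → x ∈ X → B Spans x) → ∣ X ∣ ≤ ∣ B ∣
  spanned⇒∣X∣≤∣B∣ {X} {B} iX iB spans with ∣ X ∣ ≤? ∣ B ∣
  ... | yes ∣X∣≤∣B∣ = ∣X∣≤∣B∣
  ... | no  ∣X∣≰∣B∣ with exchange iB iX (≰⇒> ∣X∣≰∣B∣)
  ...   | x , x∈X , x∉B , iB∪x = ⊥-elim (x∉B (spans x∈X iB∪x))

  spans-trans : ∀ {B B′} → Independent B → Independent B′ → ∣ B′ ∣ ≡ ∣ B ∣ →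
                (∀ {x} → x ∈ B′ → B Spans x) → ∀ {y} → B′ Spans y → B Spans y
  spans-trans {B} {B′} iB iB′ ∣B′∣≡∣B∣ spans {y} B′-spans-y iB∪y with y ∈? B
  ... | yes y∈B = y∈B
  ... | no  y∉B with exchange iB′ iB∪y (≤-reflexive (trans (cong suc ∣B′∣≡∣B∣) (sym (x∉p⇒∣p∪⁅x⁆∣≡1+∣p∣ y∉B))))
  ...   | z , z∈B∪y , z∉B′ , iB′∪z with x∈p∪⁅y⁆⁻ B y z∈B∪y
  ...     | inj₂ refl = ⊥-elim (z∉B′ (B′-spans-y iB′∪z))
  ...     | inj₁ z∈B  =
    ⊥-elim (n≮n ∣ B ∣ (≤-trans (≤-reflexive (sym ∣B′∪z∣≡1+∣B∣)) (spanned⇒∣X∣≤∣B∣ iB′∪z iB spans∪z)))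
    where
    ∣B′∪z∣≡1+∣B∣ : ∣ B′ ∪ ⁅ z ⁆ ∣ ≡ suc ∣ B ∣
    ∣B′∪z∣≡1+∣B∣ = trans (x∉p⇒∣p∪⁅x⁆∣≡1+∣p∣ z∉B′) (cong suc ∣B′∣≡∣B∣)
    spans∪z : ∀ {x} → x ∈ B′ ∪ ⁅ z ⁆ → B Spans x
    spans∪z h with x∈p∪⁅y⁆⁻ B′ z h
    ... | inj₁ x∈B′ = spans x∈B′
    ... | inj₂ refl = λ _ → z∈B

  exchange-out : ∀ {I X y} → Independent I → Independent X → y ∉ I → y ∈ X → X ⊆ I ∪ ⁅ y ⁆ → ∣ X ∣ ≤ ∣ I ∣ →
                 ∃ λ u → u ∈ I × u ∉ X × Independent ((I ∪ ⁅ y ⁆) - u)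
  exchange-out {I} {X} {y} iI iX y∉I y∈X X⊆I∪y ∣X∣≤∣I∣ with augment iX iI ∣X∣≤∣I∣
  ... | Z , X⊆Z , Z⊆X∪I , ∣Z∣≡∣I∣ , iZ = u , u∈I , u∉Z ∘ X⊆Z , hereditary I∪y-u⊆Z iZ
    where
    ∣I∪y∣≡1+∣Z∣ : ∣ I ∪ ⁅ y ⁆ ∣ ≡ suc ∣ Z ∣
    ∣I∪y∣≡1+∣Z∣ = trans (x∉p⇒∣p∪⁅x⁆∣≡1+∣p∣ y∉I) (cong suc (sym ∣Z∣≡∣I∣))
    outside-Z : ∃ λ u → u ∈ I ∪ ⁅ y ⁆ × u ∉ Z
    outside-Z = ∣p∣<∣q∣⇒∃x∈q∖p (≤-reflexive (sym ∣I∪y∣≡1+∣Z∣))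
    u = proj₁ outside-Z
    u∈I∪y = proj₁ (proj₂ outside-Z)
    u∉Z = proj₂ (proj₂ outside-Z)
    u∈I : u ∈ I
    u∈I with x∈p∪⁅y⁆⁻ I y u∈I∪y
    ... | inj₁ u∈I = u∈I
    ... | inj₂ u≡y = ⊥-elim (u∉Z (subst (_∈ Z) (sym u≡y) (X⊆Z y∈X)))
    Z⊆I∪y-u : Z ⊆ (I ∪ ⁅ y ⁆) - u
    Z⊆I∪y-u {x} x∈Z with x∈p∪q⁻ X I (Z⊆X∪I x∈Z)
    ... | inj₁ x∈X = x∈p∧x≢y⇒x∈p-y (X⊆I∪y x∈X) λ { refl → u∉Z x∈Z }
    ... | inj₂ x∈I = x∈p∧x≢y⇒x∈p-y (p⊆p∪q ⁅ y ⁆ x∈I) λ { refl → u∉Z x∈Z }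
    I∪y-u⊆Z : (I ∪ ⁅ y ⁆) - u ⊆ Z
    I∪y-u⊆Z = p⊆q⇒∣q∣≤∣p∣⇒q⊆p Z⊆I∪y-u
                (≤-reflexive (suc-injective (trans (x∈p⇒1+∣p-x∣≡∣p∣ u∈I∪y) ∣I∪y∣≡1+∣Z∣)))

module DecidableRestriction {N : ℕ} (M : Matroid N) where
  open Matroid M

  record SoundFamily : Set where
    field
      member : Subset N → Bool
      sound  : ∀ {X} → T (member X) → Independent X
  open SoundFamily

  Below : SoundFamily → Subset N → Set
  Below 𝓕 X = ∃ λ Y → X ⊆ Y × T (member 𝓕 Y)

  below? : ∀ 𝓕 → Decidable (Below 𝓕)
  below? 𝓕 X = anySubset? λ Y → X ⊆? Y ×-dec T? (member 𝓕 Y)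

  below⇒independent : ∀ 𝓕 {X} → Below 𝓕 X → Independent X
  below⇒independent 𝓕 (Y , X⊆Y , Y∈𝓕) = hereditary X⊆Y (sound 𝓕 Y∈𝓕)

  exchangeElement : SoundFamily → Subset N → Subset N → Maybe (Fin N)
  exchangeElement 𝓕 I J with below? 𝓕 I | below? 𝓕 J | ∣ I ∣ <? ∣ J ∣
  ... | yes bI | yes bJ | yes ∣I∣<∣J∣ =
    just (proj₁ (exchange (below⇒independent 𝓕 bI) (below⇒independent 𝓕 bJ) ∣I∣<∣J∣))
  ... | _      | _      | _          = nothing

  exchangeElement-complete : ∀ 𝓕 {I J} → Below 𝓕 I → Below 𝓕 J → ∣ I ∣ < ∣ J ∣ →
                             ∃ λ x → exchangeElement 𝓕 I J ≡ just x
  exchangeElement-complete 𝓕 {I} {J} bI bJ ∣I∣<∣J∣ with below? 𝓕 I | below? 𝓕 J | ∣ I ∣ <? ∣ J ∣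
  ... | yes _  | yes _  | yes _  = _ , refl
  ... | no ¬bI | _      | _      = ⊥-elim (¬bI bI)
  ... | yes _  | no ¬bJ | _      = ⊥-elim (¬bJ bJ)
  ... | yes _  | yes _  | no ¬lt = ⊥-elim (¬lt ∣I∣<∣J∣)

  exchangeElement-sound : ∀ 𝓕 I J {x} → exchangeElement 𝓕 I J ≡ just x →
                          x ∈ J × x ∉ I × Independent (I ∪ ⁅ x ⁆)
  exchangeElement-sound 𝓕 I J eq with below? 𝓕 I | below? 𝓕 J | ∣ I ∣ <? ∣ J ∣
  ... | yes bI | yes bJ | yes ∣I∣<∣J∣ with refl ← eq =
    proj₂ (exchange (below⇒independent 𝓕 bI) (below⇒independent 𝓕 bJ) ∣I∣<∣J∣)
  exchangeElement-sound 𝓕 I J () | no _  | _     | _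
  exchangeElement-sound 𝓕 I J () | yes _ | no _  | _
  exchangeElement-sound 𝓕 I J () | yes _ | yes _ | no _

  _≟ₛ_ : (X Y : Subset N) → Dec (X ≡ Y)
  _≟ₛ_ = Vec.≡-dec Bool._≟_

  Exchanges : SoundFamily → Subset N → Subset N → Subset N → Set
  Exchanges 𝓕 X I J = ∃ λ x → exchangeElement 𝓕 I J ≡ just x × X ≡ I ∪ ⁅ x ⁆

  exchanges? : ∀ 𝓕 X I J → Dec (Exchanges 𝓕 X I J)
  exchanges? 𝓕 X I J with exchangeElement 𝓕 I J
  ... | nothing = no λ ()
  ... | just x with X ≟ₛ (I ∪ ⁅ x ⁆)
  ...   | yes X≡I∪x = yes (x , refl , X≡I∪x)
  ...   | no  X≢I∪x = no λ { (_ , refl , X≡I∪x) → X≢I∪x X≡I∪x }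

  obtainedByExchange? : ∀ 𝓕 X → Dec (∃ λ I → ∃ λ J → Exchanges 𝓕 X I J)
  obtainedByExchange? 𝓕 X = anySubset? λ I → anySubset? (exchanges? 𝓕 X I)

  step : SoundFamily → SoundFamily
  member (step 𝓕) X = member 𝓕 X ∨ ⌊ obtainedByExchange? 𝓕 X ⌋
  sound  (step 𝓕) {X} X∈ with Equivalence.to T-∨ X∈
  ... | inj₁ X∈𝓕 = sound 𝓕 X∈𝓕
  ... | inj₂ exch with toWitness exch
  ...   | I , J , x , eq , refl = proj₂ (proj₂ (exchangeElement-sound 𝓕 I J eq))

  step-⊇ : ∀ 𝓕 → member 𝓕 ⊆ᵇ member (step 𝓕)
  step-⊇ 𝓕 X∈𝓕 = Equivalence.from T-∨ (inj₁ X∈𝓕)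

  step-exchange : ∀ 𝓕 I J {x} → exchangeElement 𝓕 I J ≡ just x → T (member (step 𝓕) (I ∪ ⁅ x ⁆))
  step-exchange 𝓕 I J {x} eq =
    Equivalence.from (T-∨ {member 𝓕 (I ∪ ⁅ x ⁆)})
      (inj₂ (fromWitness {a? = obtainedByExchange? 𝓕 _} (I , J , x , eq , refl)))

  Stable : SoundFamily → Set
  Stable 𝓕 = member (step 𝓕) ⊆ᵇ member 𝓕

  grows? : ∀ 𝓕 → Dec (∃ λ X → T (member (step 𝓕) X) × ¬ T (member 𝓕 X))
  grows? 𝓕 = anySubset? λ X → T? (member (step 𝓕) X) ×-dec ¬? (T? (member 𝓕 X))

  iterate : ℕ → SoundFamily → SoundFamily
  iterate zero    𝓕 = 𝓕
  iterate (suc k) 𝓕 with grows? 𝓕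
  ... | yes _ = iterate k (step 𝓕)
  ... | no  _ = 𝓕

  iterate-⊇ : ∀ k 𝓕 → member 𝓕 ⊆ᵇ member (iterate k 𝓕)
  iterate-⊇ zero    𝓕 X∈𝓕 = X∈𝓕
  iterate-⊇ (suc k) 𝓕 X∈𝓕 with grows? 𝓕
  ... | yes _ = iterate-⊇ k (step 𝓕) (step-⊇ 𝓕 X∈𝓕)
  ... | no  _ = X∈𝓕

  -- Each growing step adds a subset, and there are only 2 ^ N of them.
  iterate-stable : ∀ k 𝓕 → 2 ^ N < count (member 𝓕) + k → Stable (iterate k 𝓕)
  iterate-stable zero 𝓕 lt =
    ⊥-elim (n≮n _ (<-≤-trans lt (≤-trans (≤-reflexive (+-identityʳ _)) (count≤2^k (member 𝓕)))))
  iterate-stable (suc k) 𝓕 lt with grows? 𝓕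
  ... | yes (X , X∈step , X∉𝓕) = iterate-stable k (step 𝓕)
          (<-≤-trans lt (≤-trans (≤-reflexive (+-suc _ k))
            (+-mono-≤ (count-< {f = member 𝓕} (step-⊇ 𝓕) X X∈step X∉𝓕) ≤-refl)))
  ... | no  ¬grows = stable
    where
    stable : Stable 𝓕
    stable {X} X∈step = decidable-stable (T? (member 𝓕 X)) (λ X∉𝓕 → ¬grows (X , X∈step , X∉𝓕))

  record DecidableSubmatroid {k} (S : Fin k → Subset N) : Set₁ where
    field
      submatroid   : Matroid N
      independent? : Decidable (Matroid.Independent submatroid)
      independent⇒ : ∀ {X} → Matroid.Independent submatroid X → Independent X
      includes     : ∀ i → Matroid.Independent submatroid (S i)

  -- The sets below the closure of {∅} ∪ {S i} under exchange, which is reached after at most 2 ^ N rounds.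
  decidableSubmatroid : ∀ {k} (S : Fin k → Subset N) → (∀ i → Independent (S i)) → DecidableSubmatroid S
  decidableSubmatroid S S-independent = record
    { submatroid   = record
      { Independent = Below 𝓕*
      ; empty-indep = ⊥ , id , iterate-⊇ rounds 𝓕₀ (Equivalence.from T-∨ (inj₁ (fromWitness {a? = ⊥ ≟ₛ ⊥} refl)))
      ; hereditary  = λ { J⊆I (Y , I⊆Y , Y∈𝓕*) → Y , I⊆Y ∘ J⊆I , Y∈𝓕* }
      ; exchange    = exchange*
      }
    ; independent? = below? 𝓕*
    ; independent⇒ = below⇒independent 𝓕*
    ; includes     = λ i → S i , id , iterate-⊇ rounds 𝓕₀ (∈𝓕₀ i)
    }
    where
    𝓕₀ : SoundFamily
    member 𝓕₀ X = ⌊ X ≟ₛ ⊥ ⌋ ∨ ⌊ Fin.any? (λ i → X ≟ₛ S i) ⌋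
    sound  𝓕₀ {X} X∈ with Equivalence.to (T-∨ {⌊ X ≟ₛ ⊥ ⌋}) X∈
    ... | inj₁ X≡⊥ with refl ← toWitness X≡⊥ = empty-indep
    ... | inj₂ X≡S with (i , refl) ← toWitness X≡S = S-independent i

    ∈𝓕₀ : ∀ i → T (member 𝓕₀ (S i))
    ∈𝓕₀ i = Equivalence.from (T-∨ {⌊ S i ≟ₛ ⊥ ⌋}) (inj₂ (fromWitness (i , refl)))

    rounds : ℕ
    rounds = suc (2 ^ N)

    𝓕* : SoundFamily
    𝓕* = iterate rounds 𝓕₀

    stable : Stable 𝓕*
    stable = iterate-stable rounds 𝓕₀ (m≤n+m rounds (count (member 𝓕₀)))

    exchange* : ∀ {I J} → Below 𝓕* I → Below 𝓕* J → ∣ I ∣ < ∣ J ∣ →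
                ∃ λ x → x ∈ J × x ∉ I × Below 𝓕* (I ∪ ⁅ x ⁆)
    exchange* {I} {J} bI bJ ∣I∣<∣J∣ =
      let x , eq = exchangeElement-complete 𝓕* bI bJ ∣I∣<∣J∣
          x∈J , x∉I , _ = exchangeElement-sound 𝓕* I J eq
      in x , x∈J , x∉I , I ∪ ⁅ x ⁆ , id , stable (step-exchange 𝓕* I J eq)

module TransversalExtension
  {N : ℕ} (M : Matroid N) (independent? : Decidable (Matroid.Independent M))
  {m n : ℕ} (A : Fin m → Fin (suc n) → Fin N) (rows : ∀ i → IndepFamily M (A i)) where

  open Matroid M
  open MatroidProperties M

  Goal : Set
  Goal = IndependentTransversal M A

  open RawMonad (Sumₗ.monad Goal 0ℓ) using (_>>=_; pure)

  -- An independent transversal of all columns except the hole; row hole is junk.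
  record PartialTransversal : Set where
    field
      hole            : Fin (suc n)
      row             : Fin (suc n) → Fin m
      row-injective   : ∀ {a b} → a ≢ hole → b ≢ hole → row a ≡ row b → a ≡ b
      entry-injective : ∀ {a b} → a ≢ hole → b ≢ hole → A (row a) a ≡ A (row b) b → a ≡ b
      independent     : Independent (image (λ d → A (row d) d) (⊤ - hole))
  open PartialTransversal

  entry : PartialTransversal → Fin (suc n) → Fin N
  entry K d = A (row K d) d

  entriesIn : PartialTransversal → Subset (suc n) → Subset N
  entriesIn K W = image (entry K) (W - hole K)

  entries : PartialTransversal → Subset N
  entries K = entriesIn K ⊤

  entry∈entriesIn : ∀ K {W d} → d ∈ W → d ≢ hole K → entry K d ∈ entriesIn K W
  entry∈entriesIn K d∈W d≢hole = ∈-image⁺ (entry K) (x∈p∧x≢y⇒x∈p-y d∈W d≢hole)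

  entry∈entries : ∀ K {d} → d ≢ hole K → entry K d ∈ entries K
  entry∈entries K = entry∈entriesIn K ∈⊤

  ∈-entriesIn⁻ : ∀ K W {x} → x ∈ entriesIn K W → ∃ λ d → d ∈ W × d ≢ hole K × entry K d ≡ x
  ∈-entriesIn⁻ K W h with ∈-image⁻ (entry K) (W - hole K) h
  ... | d , d∈W-hole , entry≡x = d , x∈p-y⇒x∈p W d∈W-hole , x∈p-y⇒x≢y W d∈W-hole , entry≡x

  entriesIn⊆entries : ∀ K W → entriesIn K W ⊆ entries K
  entriesIn⊆entries K W h with ∈-entriesIn⁻ K W h
  ... | _ , _ , d≢hole , refl = entry∈entries K d≢hole

  entriesIn-independent : ∀ K W → Independent (entriesIn K W)
  entriesIn-independent K W = hereditary (entriesIn⊆entries K W) (independent K)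

  1+∣entriesIn∣≡∣W∣ : ∀ K {W} → hole K ∈ W → suc ∣ entriesIn K W ∣ ≡ ∣ W ∣
  1+∣entriesIn∣≡∣W∣ K {W} hole∈W =
    trans (cong suc (∣image∣≡∣p∣ (entry K) (W - hole K) injective)) (x∈p⇒1+∣p-x∣≡∣p∣ hole∈W)
    where
    injective : InjectiveOn (entry K) (W - hole K)
    injective a∈ b∈ = entry-injective K (x∈p-y⇒x≢y W a∈) (x∈p-y⇒x≢y W b∈)

  ∣entries∣≡n : ∀ K → ∣ entries K ∣ ≡ n
  ∣entries∣≡n K = trans (∣image∣≡∣p∣ (entry K) (⊤ - hole K) injective) (∣⊤-x∣≡n (hole K))
    where
    injective : InjectiveOn (entry K) (⊤ - hole K)
    injective a∈ b∈ = entry-injective K (x∈p-y⇒x≢y ⊤ a∈) (x∈p-y⇒x≢y ⊤ b∈)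

  Unused : PartialTransversal → Fin m → Set
  Unused K r = ∀ d → d ≢ hole K → row K d ≢ r

  fill : PartialTransversal → Fin m → Fin (suc n) → Fin m
  fill K r = updateAt (row K) (hole K) (const r)

  filled : PartialTransversal → Fin m → Fin (suc n) → Fin N
  filled K r d = A (fill K r d) d

  fill-cases : ∀ K r d → (d ≡ hole K × fill K r d ≡ r) ⊎ (d ≢ hole K × fill K r d ≡ row K d)
  fill-cases K r d with d ≟ hole K
  ... | yes refl    = inj₁ (refl , updateAt-updates (hole K) (row K))
  ... | no  d≢hole = inj₂ (d≢hole , updateAt-minimal d (hole K) (row K) d≢hole)

  filled-cases : ∀ K r d → (d ≡ hole K × filled K r d ≡ A r (hole K)) ⊎ (d ≢ hole K × filled K r d ≡ entry K d)
  filled-cases K r d with fill-cases K r d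
  ... | inj₁ (refl , fill≡r)     = inj₁ (refl , cong (λ i → A i d) fill≡r)
  ... | inj₂ (d≢hole , fill≡row) = inj₂ (d≢hole , cong (λ i → A i d) fill≡row)

  fill-injective : ∀ K {r} → Unused K r → ∀ {a b} → fill K r a ≡ fill K r b → a ≡ b
  fill-injective K {r} unused {a} {b} eq with fill-cases K r a | fill-cases K r b
  ... | inj₁ (a≡hole , _)     | inj₁ (b≡hole , _)     = trans a≡hole (sym b≡hole)
  ... | inj₁ (_ , fa≡r)       | inj₂ (b≢hole , fb≡rb) =
    ⊥-elim (unused b b≢hole (trans (sym fb≡rb) (trans (sym eq) fa≡r)))
  ... | inj₂ (a≢hole , fa≡ra) | inj₁ (_ , fb≡r)       =
    ⊥-elim (unused a a≢hole (trans (sym fa≡ra) (trans eq fb≡r)))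
  ... | inj₂ (a≢hole , fa≡ra) | inj₂ (b≢hole , fb≡rb) =
    row-injective K a≢hole b≢hole (trans (sym fa≡ra) (trans eq fb≡rb))

  filled-injective : ∀ K r {a b} →
                     (a ≢ hole K → A r (hole K) ≢ entry K a) → (b ≢ hole K → A r (hole K) ≢ entry K b) →
                     filled K r a ≡ filled K r b → a ≡ b
  filled-injective K r {a} {b} fresh-a fresh-b eq with filled-cases K r a | filled-cases K r b
  ... | inj₁ (a≡hole , _)     | inj₁ (b≡hole , _)     = trans a≡hole (sym b≡hole)
  ... | inj₁ (_ , fa≡y)       | inj₂ (b≢hole , fb≡eb) =
    ⊥-elim (fresh-b b≢hole (trans (sym fa≡y) (trans eq fb≡eb)))
  ... | inj₂ (a≢hole , fa≡ea) | inj₁ (_ , fb≡y)       =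
    ⊥-elim (fresh-a a≢hole (trans (sym fb≡y) (trans (sym eq) fa≡ea)))
  ... | inj₂ (a≢hole , fa≡ea) | inj₂ (b≢hole , fb≡eb) =
    entry-injective K a≢hole b≢hole (trans (sym fa≡ea) (trans eq fb≡eb))

  filled∈entries∪new : ∀ K r d → filled K r d ∈ entries K ∪ ⁅ A r (hole K) ⁆
  filled∈entries∪new K r d with filled-cases K r d
  ... | inj₁ (_ , f≡y)      = subst (_∈ entries K ∪ ⁅ A r (hole K) ⁆) (sym f≡y) (y∈p∪⁅y⁆ (entries K) _)
  ... | inj₂ (d≢hole , f≡e) = subst (_∈ entries K ∪ ⁅ A r (hole K) ⁆) (sym f≡e) (p⊆p∪q _ (entry∈entries K d≢hole))

  fillHole : ∀ K r → Unused K r → A r (hole K) ∉ entries K → Independent (entries K ∪ ⁅ A r (hole K) ⁆) → Goal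
  fillHole K r unused new∉ indep =
    fill K r , fill-injective K unused , filled-injective K r fresh fresh , hereditary setOf-filled⊆ indep
    where
    fresh : ∀ {d} → d ≢ hole K → A r (hole K) ≢ entry K d
    fresh d≢hole new≡entry = new∉ (subst (_∈ entries K) (sym new≡entry) (entry∈entries K d≢hole))
    setOf-filled⊆ : setOf (filled K r) ⊆ entries K ∪ ⁅ A r (hole K) ⁆
    setOf-filled⊆ h with ∈-setOf⁻ (filled K r) h
    ... | d , refl = filled∈entries∪new K r d

  record Move (K : PartialTransversal) (r : Fin m) (c : Fin (suc n)) : Set where
    field
      c≢hole             : c ≢ hole K
      new-entry-fresh    : ∀ {d} → d ≢ hole K → d ≢ c → A r (hole K) ≢ entry K d
      filled-independent : Independent (image (filled K r) (⊤ - c))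
  open Move

  move : ∀ K {r c} → Unused K r → Move K r c → PartialTransversal
  move K {r} {c} unused mv = record
    { hole            = c
    ; row             = fill K r
    ; row-injective   = λ _ _ → fill-injective K unused
    ; entry-injective = λ a≢c b≢c →
        filled-injective K r (λ a≢hole → new-entry-fresh mv a≢hole a≢c) (λ b≢hole → new-entry-fresh mv b≢hole b≢c)
    ; independent     = filled-independent mv
    }

  duplicateMove : ∀ K r {c} → c ≢ hole K → entry K c ≡ A r (hole K) → Move K r c
  duplicateMove K r {c} c≢hole entry≡new = record
    { c≢hole             = c≢hole
    ; new-entry-fresh    = λ d≢hole d≢c new≡entry →
        d≢c (sym (entry-injective K c≢hole d≢hole (trans entry≡new new≡entry)))
    ; filled-independent = hereditary filled⊆entries (independent K)
    }
    where
    filled⊆entries : image (filled K r) (⊤ - c) ⊆ entries K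
    filled⊆entries h with ∈-image⁻ (filled K r) (⊤ - c) h
    ... | d , _ , refl with filled-cases K r d
    ...   | inj₁ (_ , f≡new)     = subst (_∈ entries K) (trans entry≡new (sym f≡new)) (entry∈entries K c≢hole)
    ...   | inj₂ (d≢hole , f≡e) = subst (_∈ entries K) (sym f≡e) (entry∈entries K d≢hole)

  exchangeMove : ∀ K r {c} → c ≢ hole K → A r (hole K) ∉ entries K →
                 Independent ((entries K ∪ ⁅ A r (hole K) ⁆) - entry K c) → Move K r c
  exchangeMove K r {c} c≢hole new∉ indep = record
    { c≢hole             = c≢hole
    ; new-entry-fresh    = λ d≢hole _ new≡entry → new∉ (subst (_∈ entries K) (sym new≡entry) (entry∈entries K d≢hole))
    ; filled-independent = hereditary filled⊆ indep
    }
    where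
    filled≢entry : ∀ {d} → d ≢ c → filled K r d ≢ entry K c
    filled≢entry {d} d≢c f≡entry with filled-cases K r d
    ... | inj₁ (_ , f≡new)     = new∉ (subst (_∈ entries K) (trans (sym f≡entry) f≡new) (entry∈entries K c≢hole))
    ... | inj₂ (d≢hole , f≡e) = d≢c (entry-injective K d≢hole c≢hole (trans (sym f≡e) f≡entry))
    filled⊆ : image (filled K r) (⊤ - c) ⊆ (entries K ∪ ⁅ A r (hole K) ⁆) - entry K c
    filled⊆ h with ∈-image⁻ (filled K r) (⊤ - c) h
    ... | d , d∈⊤-c , refl = x∈p∧x≢y⇒x∈p-y (filled∈entries∪new K r d) (filled≢entry (x∈p-y⇒x≢y ⊤ d∈⊤-c))

  augmentingMove : ∀ K r {Q} → (∀ {d} → d ∈ Q → d ≢ hole K) → A r (hole K) ∉ entries K →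
                   Independent (image (entry K) Q ∪ ⁅ A r (hole K) ⁆) → ∣ image (entry K) Q ∪ ⁅ A r (hole K) ⁆ ∣ ≤ n →
                   ∃ λ c → c ∉ Q × Move K r c
  augmentingMove K r {Q} Q-avoids-hole new∉ indep size =
    let u , u∈entries , u∉X , indep′ = exchange-out (independent K) indep new∉ (y∈p∪⁅y⁆ _ _) X⊆entries∪new size′
        c , _ , c≢hole , entry≡u     = ∈-entriesIn⁻ K ⊤ u∈entries
    in c , (λ c∈Q → u∉X (subst (_∈ X) entry≡u (p⊆p∪q _ (∈-image⁺ (entry K) c∈Q))))
         , exchangeMove K r c≢hole new∉ (subst (λ u → Independent ((entries K ∪ ⁅ y ⁆) - u)) (sym entry≡u) indep′)
    where
    y = A r (hole K)
    X = image (entry K) Q ∪ ⁅ y ⁆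
    X⊆entries∪new : X ⊆ entries K ∪ ⁅ y ⁆
    X⊆entries∪new h with x∈p∪⁅y⁆⁻ (image (entry K) Q) (A r (hole K)) h
    ... | inj₂ refl = y∈p∪⁅y⁆ _ _
    ... | inj₁ h′ with ∈-image⁻ (entry K) Q h′
    ...   | d , d∈Q , refl = p⊆p∪q _ (entry∈entries K (Q-avoids-hole d∈Q))
    size′ : ∣ X ∣ ≤ ∣ entries K ∣
    size′ = ≤-trans size (≤-reflexive (sym (∣entries∣≡n K)))

  _spans?_ : ∀ B x → Dec (B Spans x)
  B spans? x with x ∈? B
  ... | yes x∈B = yes (const x∈B)
  ... | no  x∉B with independent? (B ∪ ⁅ x ⁆)
  ...   | yes indep = no λ spans → x∉B (spans indep)
  ...   | no  dep   = yes (⊥-elim ∘ dep)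

  module FromStart (K₀ : PartialTransversal) where

    data Reachable (P : Subset m) : PartialTransversal → Set where
      start : Reachable P K₀
      next  : ∀ {K r c} → Reachable P K → (unused : Unused K r) (mv : Move K r c) → r ∉ P →
              Reachable P (move K unused mv)

    Reachable-anti : ∀ {P P′} → P ⊆ P′ → ∀ {K} → Reachable P′ K → Reachable P K
    Reachable-anti P⊆P′ start                    = start
    Reachable-anti P⊆P′ (next rK unused mv r∉P′) = next (Reachable-anti P⊆P′ rK) unused mv (r∉P′ ∘ P⊆P′)

    Reachable-unused : ∀ {P K} → Reachable P K → ∀ {r} → r ∈ P → Unused K₀ r → Unused K r
    Reachable-unused start                          _   unused₀ = unused₀
    Reachable-unused (next {K} {r′} rK _ _ r′∉P) {r} r∈P unused₀ d d≢hole fill≡r with fill-cases K r′ d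
    ... | inj₁ (_ , fill≡r′)       = r′∉P (subst (_∈ _) (trans (sym fill≡r) fill≡r′) r∈P)
    ... | inj₂ (d≢hole₀ , fill≡row) = Reachable-unused rK r∈P unused₀ d d≢hole₀ (trans (sym fill≡row) fill≡r)

    HolesIn : Subset m → Subset (suc n) → Set
    HolesIn P W = ∀ {K} → Reachable P K → Goal ⊎ hole K ∈ W

    SpannedFromStart : Subset (suc n) → PartialTransversal → Set
    SpannedFromStart W K = ∀ {x} → x ∈ entriesIn K W → entriesIn K₀ W Spans x

    W≡⊤-if-large : ∀ K {W y} → hole K ∈ W → y ∉ entriesIn K W → n < ∣ entriesIn K W ∪ ⁅ y ⁆ ∣ → W ≡ ⊤
    W≡⊤-if-large K {W} {y} hole∈W y∉ large = ∣p∣≡n⇒p≡⊤ (≤-antisym (∣p∣≤n W) (begin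
      suc n                     ≤⟨ large ⟩
      ∣ entriesIn K W ∪ ⁅ y ⁆ ∣ ≡⟨ x∉p⇒∣p∪⁅x⁆∣≡1+∣p∣ y∉ ⟩
      suc ∣ entriesIn K W ∣     ≡⟨ 1+∣entriesIn∣≡∣W∣ K hole∈W ⟩
      ∣ W ∣                     ∎))
      where open ≤-Reasoning

    new-entry-spanned : ∀ {P W} → HolesIn P W → ∀ {K r} → Reachable P K → SpannedFromStart W K →
                        Unused K r → r ∉ P → Goal ⊎ entriesIn K₀ W Spans A r (hole K)
    new-entry-spanned {P} {W} holes {K} {r} rK spanned unused r∉P = do
      hole∈W  ← holes rK
      hole₀∈W ← holes start
      byCases hole∈W hole₀∈W (y ∈? entries K) (independent? (entriesIn K W ∪ ⁅ y ⁆))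
                             (∣ entriesIn K W ∪ ⁅ y ⁆ ∣ ≤? n)
      where
      y : Fin N
      y = A r (hole K)
      byCases : hole K ∈ W → hole K₀ ∈ W → Dec (y ∈ entries K) → Dec (Independent (entriesIn K W ∪ ⁅ y ⁆)) →
                Dec (∣ entriesIn K W ∪ ⁅ y ⁆ ∣ ≤ n) → Goal ⊎ entriesIn K₀ W Spans y
      byCases _ _ (yes y∈entries) _ _ = do
        let c , _ , c≢hole , entry≡y = ∈-entriesIn⁻ K ⊤ y∈entries
        c∈W ← holes (next rK unused (duplicateMove K r c≢hole entry≡y) r∉P)
        pure (spanned (subst (_∈ entriesIn K W) entry≡y (entry∈entriesIn K c∈W c≢hole)))
      byCases hole∈W hole₀∈W (no _) (no dependent) _ =
        pure (spans-trans (entriesIn-independent K₀ W) (entriesIn-independent K W) same-size spanned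
                          (⊥-elim ∘ dependent))
        where
        same-size : ∣ entriesIn K W ∣ ≡ ∣ entriesIn K₀ W ∣
        same-size = suc-injective (trans (1+∣entriesIn∣≡∣W∣ K hole∈W) (sym (1+∣entriesIn∣≡∣W∣ K₀ hole₀∈W)))
      byCases hole∈W _ (no y∉entries) (yes indep) (no large) =
        inj₁ (fillHole K r unused y∉entries (subst (λ W → Independent (entriesIn K W ∪ ⁅ y ⁆)) W≡⊤ indep))
        where
        W≡⊤ : W ≡ ⊤
        W≡⊤ = W≡⊤-if-large K hole∈W (y∉entries ∘ entriesIn⊆entries K W) (≰⇒> large)
      -- Augmenting would move the hole to a column outside W.
      byCases _ _ (no y∉entries) (yes indep) (yes small) = do
        let c , c∉W-hole , mv = augmentingMove K r (x∈p-y⇒x≢y W) y∉entries indep small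
        c∈W ← holes (next rK unused mv r∉P)
        ⊥-elim (c∉W-hole (x∈p∧x≢y⇒x∈p-y c∈W (c≢hole mv)))

    reachable-spanned : ∀ {P W} → HolesIn P W → ∀ {K} → Reachable P K → Goal ⊎ SpannedFromStart W K
    reachable-spanned holes start = inj₂ const
    reachable-spanned {W = W} holes (next {K} {r} {c} rK unused mv r∉P) = do
      spanned ← reachable-spanned holes rK
      new-spanned ← new-entry-spanned holes rK spanned unused r∉P
      pure (λ {x} → spanned′ spanned new-spanned {x})
      where
      spanned′ : SpannedFromStart W K → entriesIn K₀ W Spans A r (hole K) → SpannedFromStart W (move K unused mv)
      spanned′ spanned new-spanned h with ∈-entriesIn⁻ (move K unused mv) W h
      ... | d , d∈W , _ , refl with filled-cases K r d
      ...   | inj₁ (_ , f≡new)     = subst (entriesIn K₀ W Spans_) (sym f≡new) new-spanned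
      ...   | inj₂ (d≢hole , f≡e) = subst (entriesIn K₀ W Spans_) (sym f≡e) (spanned (entry∈entriesIn K d∈W d≢hole))

    new-entry-spanned-reachable : ∀ {P W} → HolesIn P W → ∀ {K r} → Reachable P K →
                                  Unused K r → r ∉ P → Goal ⊎ entriesIn K₀ W Spans A r (hole K)
    new-entry-spanned-reachable holes rK unused r∉P = do
      spanned ← reachable-spanned holes rK
      new-entry-spanned holes rK spanned unused r∉P

    spannedColumn? : ∀ W r → Decidable (λ w → entriesIn K₀ W Spans A r w)
    spannedColumn? W r w = entriesIn K₀ W spans? A r w

    shrink : Subset (suc n) → Fin m → Subset (suc n)
    shrink W r = filter (spannedColumn? W r) W

    shrink-holes : ∀ {P W} → HolesIn P W → ∀ {r} → Unused K₀ r → r ∉ P → HolesIn (P ∪ ⁅ r ⁆) (shrink W r)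
    shrink-holes {P} {W} holes {r} unused₀ r∉P rK′ = do
      hole∈W ← holes rK
      new-spanned ← new-entry-spanned-reachable holes rK (Reachable-unused rK′ (y∈p∪⁅y⁆ P r) unused₀) r∉P
      pure (∈-filter⁺ (spannedColumn? W r) hole∈W new-spanned)
      where
      rK = Reachable-anti (p⊆p∪q ⁅ r ⁆) rK′

    -- Row r restricted to shrink W r is independent and spanned by the |W| − 1 entries of K₀ in W.
    ∣shrink∣<∣W∣ : ∀ {W} r → hole K₀ ∈ W → ∣ shrink W r ∣ < ∣ W ∣
    ∣shrink∣<∣W∣ {W} r hole₀∈W = ≤-trans (s≤s ∣shrink∣≤∣entriesIn∣) (≤-reflexive (1+∣entriesIn∣≡∣W∣ K₀ hole₀∈W))
      where
      row-part : Subset N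
      row-part = image (A r) (shrink W r)
      row-part-independent : Independent row-part
      row-part-independent = hereditary row-part⊆row (proj₂ (rows r))
        where
        row-part⊆row : row-part ⊆ setOf (A r)
        row-part⊆row h with ∈-image⁻ (A r) (shrink W r) h
        ... | w , _ , refl = ∈-setOf⁺ (A r) w
      ∣row-part∣≡∣shrink∣ : ∣ row-part ∣ ≡ ∣ shrink W r ∣
      ∣row-part∣≡∣shrink∣ = ∣image∣≡∣p∣ (A r) (shrink W r) (λ _ _ → proj₁ (rows r))
      row-part-spanned : ∀ {x} → x ∈ row-part → entriesIn K₀ W Spans x
      row-part-spanned h with ∈-image⁻ (A r) (shrink W r) h
      ... | w , w∈shrink , refl = proj₂ (∈-filter⁻ (spannedColumn? W r) w∈shrink)
      ∣shrink∣≤∣entriesIn∣ : ∣ shrink W r ∣ ≤ ∣ entriesIn K₀ W ∣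
      ∣shrink∣≤∣entriesIn∣ = ≤-trans (≤-reflexive (sym ∣row-part∣≡∣shrink∣))
        (spanned⇒∣X∣≤∣B∣ row-part-independent (entriesIn-independent K₀ W) row-part-spanned)

    moveFromStart : ∀ r → 1 ≤ n → ∃ λ c → Move K₀ r c
    moveFromStart r 1≤n = byMembership (A r (hole K₀) ∈? entries K₀)
      where
      X = image (entry K₀) ⊥ ∪ ⁅ A r (hole K₀) ⁆
      X⊆row : X ⊆ setOf (A r)
      X⊆row h with x∈p∪⁅y⁆⁻ (image (entry K₀) ⊥) (A r (hole K₀)) h
      ... | inj₁ h′ = ⊥-elim (y∉image⊥ (entry K₀) h′)
      ... | inj₂ refl = ∈-setOf⁺ (A r) (hole K₀)
      small : ∣ X ∣ ≤ n
      small = ≤-trans (≤-reflexive (trans (x∉p⇒∣p∪⁅x⁆∣≡1+∣p∣ (y∉image⊥ (entry K₀)))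
                                          (cong suc (∣image∣≡∣p∣ (entry K₀) ⊥ (⊥-elim ∘ ∉⊥)))))
                      (≤-trans (s≤s (≤-reflexive (∣⊥∣≡0 (suc n)))) 1≤n)
      byMembership : Dec (A r (hole K₀) ∈ entries K₀) → ∃ λ c → Move K₀ r c
      byMembership (yes new∈entries) =
        let c , _ , c≢hole , entry≡new = ∈-entriesIn⁻ K₀ ⊤ new∈entries in c , duplicateMove K₀ r c≢hole entry≡new
      byMembership (no new∉entries) =
        map₂ proj₂ (augmentingMove K₀ r (⊥-elim ∘ ∉⊥) new∉entries (hereditary X⊆row (proj₂ (rows r))) small)

    2≤∣W∣ : ∀ {P W r} → HolesIn P W → 1 ≤ n → Unused K₀ r → r ∉ P → Goal ⊎ 2 ≤ ∣ W ∣
    2≤∣W∣ {r = r} holes 1≤n unused r∉P = do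
      let c , mv = moveFromStart r 1≤n
      hole₀∈W ← holes start
      c∈W ← holes (next start unused mv r∉P)
      pure (x≢y⇒2≤∣p∣ hole₀∈W c∈W (c≢hole mv ∘ sym))

    usedRows : Subset m
    usedRows = image (row K₀) (⊤ - hole K₀)

    ∣usedRows∣≡n : ∣ usedRows ∣ ≡ n
    ∣usedRows∣≡n = trans (∣image∣≡∣p∣ (row K₀) (⊤ - hole K₀) injective) (∣⊤-x∣≡n (hole K₀))
      where
      injective : InjectiveOn (row K₀) (⊤ - hole K₀)
      injective a∈ b∈ = row-injective K₀ (x∈p-y⇒x≢y ⊤ a∈) (x∈p-y⇒x≢y ⊤ b∈)

    ∉usedRows⇒unused : ∀ {r} → r ∉ usedRows → Unused K₀ r
    ∉usedRows⇒unused r∉usedRows d d≢hole row≡r =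
      r∉usedRows (subst (_∈ usedRows) row≡r (∈-image⁺ (row K₀) (x∈p∧x≢y⇒x∈p-y ∈⊤ d≢hole)))

    freshRow : ∀ P → ∣ P ∣ ≤ n → suc (n + n) ≤ m → ∃ λ r → Unused K₀ r × r ∉ P
    freshRow P ∣P∣≤n 2n+1≤m =
      let r , _ , r∉usedRows∪P = ∣p∣<∣q∣⇒∃x∈q∖p {p = usedRows ∪ P} {q = ⊤} ∣usedRows∪P∣<m
      in r , ∉usedRows⇒unused (r∉usedRows∪P ∘ p⊆p∪q P) , r∉usedRows∪P ∘ q⊆p∪q usedRows P
      where
      open ≤-Reasoning
      ∣usedRows∪P∣<m : ∣ usedRows ∪ P ∣ < ∣ ⊤ {m} ∣
      ∣usedRows∪P∣<m = begin-strict
        ∣ usedRows ∪ P ∣     ≤⟨ ∣p∪q∣≤∣p∣+∣q∣ usedRows P ⟩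
        ∣ usedRows ∣ + ∣ P ∣ ≡⟨ cong (_+ ∣ P ∣) ∣usedRows∣≡n ⟩
        n + ∣ P ∣            ≤⟨ +-monoʳ-≤ n ∣P∣≤n ⟩
        n + n                <⟨ 2n+1≤m ⟩
        m                    ≡⟨ ∣⊤∣≡n m ⟨
        ∣ ⊤ {m} ∣            ∎

    exhaust : 1 ≤ n → suc (n + n) ≤ m → ∀ k {P W} → HolesIn P W → ∣ P ∣ + k ≡ n → ∣ W ∣ ≤ suc k → Goal
    exhaust 1≤n 2n+1≤m k {P} {W} holes ∣P∣+k≡n ∣W∣≤1+k
      with freshRow P (≤-trans (m≤m+n ∣ P ∣ k) (≤-reflexive ∣P∣+k≡n)) 2n+1≤m
    exhaust 1≤n 2n+1≤m zero {P} {W} holes ∣P∣+k≡n ∣W∣≤1 | r , unused , r∉P =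
      fromInj₁ (λ 2≤∣W∣ → ⊥-elim (n≮n 1 (≤-trans 2≤∣W∣ ∣W∣≤1))) (2≤∣W∣ holes 1≤n unused r∉P)
    exhaust 1≤n 2n+1≤m (suc k) {P} {W} holes ∣P∣+k≡n ∣W∣≤2+k | r , unused , r∉P =
      fromInj₁ continue (holes start)
      where
      continue : hole K₀ ∈ W → Goal
      continue hole₀∈W = exhaust 1≤n 2n+1≤m k (shrink-holes holes unused r∉P)
        (trans (cong (_+ k) (x∉p⇒∣p∪⁅x⁆∣≡1+∣p∣ r∉P)) (trans (sym (+-suc ∣ P ∣ k)) ∣P∣+k≡n))
        (≤-pred (≤-trans (∣shrink∣<∣W∣ r hole₀∈W) ∣W∣≤2+k))

    transversal : 1 ≤ n → suc (n + n) ≤ m → Goal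
    transversal 1≤n 2n+1≤m =
      exhaust 1≤n 2n+1≤m n {P = ⊥} {W = ⊤} (λ _ → inj₂ ∈⊤) (cong (_+ n) (∣⊥∣≡0 m)) (≤-reflexive (∣⊤∣≡n (suc n)))

  -- r₀ only fills the junk row of the hole.
  holeAtZero : Fin m → IndependentTransversal M (λ i j → A i (suc j)) → PartialTransversal
  holeAtZero r₀ (ρ , ρ-injective , entries-injective , entries-independent) = record
    { hole            = zero
    ; row             = r₀ Vector.∷ ρ
    ; row-injective   = injective-off-zero ρ-injective
    ; entry-injective = injective-off-zero entries-injective
    ; independent     = hereditary image⊆entries entries-independent
    }
    where
    image⊆entries : image (λ d → A ((r₀ Vector.∷ ρ) d) d) (⊤ - zero) ⊆ setOf (λ j → A (ρ j) (suc j))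
    image⊆entries h with ∈-image⁻ (λ d → A ((r₀ Vector.∷ ρ) d) d) (⊤ - zero) h
    ... | zero  , 0∈⊤-0 , _ = ⊥-elim (x∈p-y⇒x≢y ⊤ 0∈⊤-0 refl)
    ... | suc j , _ , refl  = ∈-setOf⁺ (λ j → A (ρ j) (suc j)) j

  extend : 1 ≤ n → 2 * suc n ∸ 1 ≤ m → IndependentTransversal M (λ i j → A i (suc j)) → Goal
  extend 1≤n 2n+1≤m′ tail = FromStart.transversal (holeAtZero r₀ tail) 1≤n 2n+1≤m
    where
    2n+1≤m : suc (n + n) ≤ m
    2n+1≤m = ≤-trans (≤-reflexive (sym (trans (+-suc n (n + 0)) (cong (λ k → suc (n + k)) (+-identityʳ n))))) 2n+1≤m′
    r₀ : Fin m
    r₀ = fromℕ< (≤-trans (s≤s z≤n) 2n+1≤m)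

rows-tail : ∀ {N m n} (M : Matroid N) (A : Fin m → Fin (suc n) → Fin N) →
            (∀ i → IndepFamily M (A i)) → ∀ i → IndepFamily M (λ j → A i (suc j))
rows-tail M A rows i = Fin.suc-injective ∘ proj₁ (rows i) , Matroid.hereditary M tail⊆row (proj₂ (rows i))
  where
  tail⊆row : setOf (λ j → A i (suc j)) ⊆ setOf (A i)
  tail⊆row h with ∈-setOf⁻ (λ j → A i (suc j)) h
  ... | j , refl = ∈-setOf⁺ (A i) (suc j)

transversal : ∀ {N} (M : Matroid N) → Decidable (Matroid.Independent M) →
              ∀ n {m} (A : Fin m → Fin n → Fin N) → (∀ i → IndepFamily M (A i)) → 2 * n ∸ 1 ≤ m →
              IndependentTransversal M A
transversal M _ zero A _ _ = (λ ()) , (λ { {()} }) , (λ { {()} }) , Matroid.empty-indep M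
transversal M _ (suc zero) {suc m} A rows _ = (λ _ → zero) , Fin1-injective , Fin1-injective , proj₂ (rows zero)
  where
  Fin1-injective : ∀ {B : Set} {f : Fin 1 → B} {x y} → f x ≡ f y → x ≡ y
  Fin1-injective {x = zero} {zero} _ = refl
transversal M independent? (suc (suc n)) A rows 2n+3≤m =
  TransversalExtension.extend M independent? A rows (s≤s z≤n) 2n+3≤m
    (transversal M independent? (suc n) (λ i j → A i (suc j)) (rows-tail M A rows) 2n+1≤m)
  where
  2n+1≤m : 2 * suc n ∸ 1 ≤ _
  2n+1≤m = ≤-trans (∸-monoˡ-≤ 1 (*-monoʳ-≤ 2 (n≤1+n (suc n)))) 2n+3≤m

theorem2 : (N : ℕ) (M : Matroid N) (m n : ℕ) → .{{NonZero m}} → .{{NonZero n}} →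
    (A : Fin m → Fin n → Fin N) →
    (∀ i → IndepFamily M (A i)) →
    2 * n ∸ 1 ≤ m →
    IndependentTransversal M A
theorem2 N M m n A rows 2n-1≤m =
  map₂ (map₂ (map₂ independent⇒)) (transversal submatroid independent? n A rows′ 2n-1≤m)
  where
  open DecidableRestriction M using (DecidableSubmatroid; decidableSubmatroid)
  open DecidableSubmatroid (decidableSubmatroid (setOf ∘ A) (proj₂ ∘ rows))
  rows′ : ∀ i → IndepFamily submatroid (A i)
  rows′ i = proj₁ (rows i) , includes i
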